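{- Let $\Gamma$ be a bipartite $(7,3,-4)$-graph. Then $\Gamma_2$ cannot be a spanning subgraph of $\Gamma$ (i.e., $V(\Gamma_2)\neq V(\Gamma)$).
   Context: All graphs are simple. The bipartite Moore bound is $\mathcal{M}^b(d,D)=2(1+(d-1)+\dots+(d-1)^{D-1})$; a bipartite $(d,D,-\epsilon)$-graph is a bipartite graph of maximum degree $d$, diameter $D$ and order $\mathcal{M}^b(d,D)-\epsilon$ (so a bipartite $(7,3,-4)$-graph has $82$ vertices). In a bipartite $(d,3,-4)$-graph $\Gamma$, a short cycle is a cycle of length at most $4$; two distinct short cycles are neighbors if they share a vertex. $S_2(\Gamma)$ (resp. $S_1(\Gamma)$, $S_0(\Gamma)$) denotes the set of short cycles of $\Gamma$ whose intersections with their neighbor cycles are paths of length $2$ (resp. length $1$, resp. length at most $0$); $\Gamma_i$ is the subgraph of $\Gamma$ formed by the union of all cycles in $S_i(\Gamma)$, $i=0,1,2$. -}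

module Defs where

open import Data.Nat using (ℕ; zero; suc; _≤_; _<?_)
open import Data.Fin using (Fin; zero; suc; toℕ; fromℕ<)
open import Data.Fin.Properties using (_≟_)
open import Data.Bool using (Bool; true; false)
open import Data.List using (List; length; filter; allFin)
open import Data.Product using (Σ; ∃; ∃-syntax; _×_; _,_)
open import Data.Sum using (_⊎_)
open import Function.Bundles using (_⇔_)
open import Function.Definitions using (Injective)
open import Relation.Nullary using (¬_; yes; no)
open import Relation.Binary.PropositionalEquality using (_≡_; _≢_)

record Graph (n : ℕ) : Set where
  field
    adj     : Fin n → Fin n → Bool
    symm    : ∀ u v → adj u v ≡ adj v u
    irrefl  : ∀ v → adj v v ≡ false

module _ {n : ℕ} (G : Graph n) where
  open Graph G

  Adj : Fin n → Fin n → Set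
  Adj u v = adj u v ≡ true

  degree : Fin n → ℕ
  degree v = length (filter (λ u → Data.Bool._≟_ (adj v u) true) (allFin n))

  MaxDegree : ℕ → Set
  MaxDegree d = (∀ v → degree v ≤ d) × (∃[ v ] degree v ≡ d)

  Within : ℕ → Fin n → Fin n → Set
  Within zero    u v = u ≡ v
  Within (suc k) u v = u ≡ v ⊎ (∃[ w ] (Adj u w × Within k w v))

  Diameter : ℕ → Set
  Diameter zero    = ∀ u v → Within zero u v
  Diameter (suc D) = (∀ u v → Within (suc D) u v) × (∃[ u ] ∃[ v ] ¬ Within D u v)

  Bipartite : Set
  Bipartite = Σ (Fin n → Bool) λ c → ∀ u v → Adj u v → c u ≢ c v


next : ∀ {m} → Fin (suc m) → Fin (suc m)
next {m} i with suc (toℕ i) <? suc m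
... | yes p = fromℕ< p
... | no _  = zero

module _ {n : ℕ} (G : Graph n) where

  record ShortCycle : Set where
    field
      len₋₁  : ℕ
      3≤len  : 3 ≤ suc len₋₁
      len≤4  : suc len₋₁ ≤ 4
      vert   : Fin (suc len₋₁) → Fin n
      inj    : Injective _≡_ _≡_ vert
      adjc   : ∀ i → Adj G (vert i) (vert (next i))

  open ShortCycle

  OnCycle : ShortCycle → Fin n → Set
  OnCycle C v = ∃[ i ] vert C i ≡ v

  CycleEdge : ShortCycle → Fin n → Fin n → Set
  CycleEdge C u v = ∃[ i ] ((vert C i ≡ u × vert C (next i) ≡ v)
                           ⊎ (vert C i ≡ v × vert C (next i) ≡ u))

  -- two cycles are the same subgraph iff they have the same edge set
  -- (the vertex set of a cycle is determined by its edges)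
  SameCycle : ShortCycle → ShortCycle → Set
  SameCycle C D = ∀ u v → CycleEdge C u v ⇔ CycleEdge D u v

  Neighbors : ShortCycle → ShortCycle → Set
  Neighbors C D = ¬ SameCycle C D × (∃[ v ] (OnCycle C v × OnCycle D v))

  IntersectionIsP₂ : ShortCycle → ShortCycle → Set
  IntersectionIsP₂ C D =
    ∃[ x ] ∃[ y ] ∃[ z ] (x ≢ y × y ≢ z × x ≢ z
      × (∀ w → (OnCycle C w × OnCycle D w) ⇔ (w ≡ x ⊎ w ≡ y ⊎ w ≡ z))
      × (∀ u v → (CycleEdge C u v × CycleEdge D u v)
                 ⇔ (((u ≡ x × v ≡ y) ⊎ (u ≡ y × v ≡ x))
                   ⊎ ((u ≡ y × v ≡ z) ⊎ (u ≡ z × v ≡ y)))))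

  InS₂ : ShortCycle → Set
  InS₂ C = (∃[ D ] Neighbors C D) × (∀ D → Neighbors C D → IntersectionIsP₂ C D)

  InΓ₂ : Fin n → Set
  InΓ₂ v = ∃[ C ] (InS₂ C × OnCycle C v)

-- bipartite (d,D,-ε)-graph with n = M^b(d,D) - ε vertices
module _ {n : ℕ} (G : Graph n) where
  BipartiteGraph : ℕ → ℕ → Set
  BipartiteGraph d D = Bipartite G × MaxDegree G d × Diameter G D

-- Let codeg x y be the number of common neighbours of x and y, and call
-- codeg x y − 1 (for y ≠ x) the excess of y over x: the 2-walks from x to y
-- beyond the first.  Counting the 2-walks from x in a bipartite graph of
-- maximum degree d and diameter 3 shows that the colour class of x plus the
-- total excess at x is at most 1 + (d−1) + (d−1)², which is 43 for d = 7
-- (module TwoWalks).  The two ends of an edge have complementary colour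
-- classes, so their total excesses add up to at most 2·43 − 82 = 4.
--
-- If Γ₂ spans Γ, every vertex lies in a K₂,₃ (module Squares: short cycles
-- are 4-cycles, and two of them sharing a path of length 2 make a K₂,₃);
-- this gives total excess ≥ 2 everywhere, hence exactly 2.  Then (module
-- ThickPairs) a pole of a K₂,₃ has exactly one thick partner (a vertex with
-- three common neighbours) and is a common neighbour of no thick pair, while
-- a middle vertex has no thick partner and is a common neighbour of exactly
-- two ordered thick pairs.  Double counting thick pairs against their three
-- common neighbours yields 5 · #(ordered thick pairs) = 2 · 82, impossible.

module Submission where

open import Defs
open import Data.Nat using (ℕ; zero; suc; _+_; _*_; _∸_; _≤_; _≤?_; z≤n; s≤s)
open import Data.Nat.Properties hiding (_≟_)
open import Data.Nat.DivMod using (_%_; m*n%n≡0)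
open import Data.Nat.Tactic.RingSolver using (solve-∀)
open import Data.Bool using (Bool; true)
open import Data.Bool.Properties using (¬-not) renaming (_≟_ to _≟ᵇ_)
open import Data.Empty using (⊥)
open import Data.Fin using (Fin; zero; suc; punchIn; punchOut)
open import Data.Fin.Properties using (_≟_; punchIn-injective; punchInᵢ≢i; punchIn-punchOut)
open import Data.List using (length; filter; tabulate)
open import Data.Product using (∃-syntax; _×_; _,_; proj₁; proj₂; uncurry)
open import Data.Sum using (_⊎_; inj₁; inj₂; [_,_])
open import Data.Vec.Functional using (removeAt)
open import Function using (_∘_; case_of_)
open import Function.Bundles using (_⇔_; mk⇔; Equivalence)
open import Relation.Binary.PropositionalEquality
  using (_≡_; _≢_; refl; sym; trans; cong; cong₂; subst; module ≡-Reasoning)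
open import Relation.Nullary using (¬_; Dec; yes; no; contradiction)
open import Relation.Nullary.Decidable using (_×-dec_; ¬?)
open import Relation.Unary using (Decidable)
open import Algebra.Properties.CommutativeSemigroup +-commutativeSemigroup using (interchange)
open import Algebra.Properties.Semiring.Sum +-*-semiring
  using (sum; sum-syntax; sum-remove; sum-cong-≗; sum-replicate-zero; ∑-comm; ∑-distrib-+;
         *-distribˡ-sum; *-distribʳ-sum)

𝟙 : ∀ {p} {P : Set p} → Dec P → ℕ
𝟙 (yes _) = 1
𝟙 (no _)  = 0

module _ {p} {P : Set p} where

  𝟙-yes : P → (d : Dec P) → 𝟙 d ≡ 1
  𝟙-yes _ (yes _)  = refl
  𝟙-yes x (no ¬x) = contradiction x ¬x

  𝟙-no : ¬ P → (d : Dec P) → 𝟙 d ≡ 0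
  𝟙-no ¬x (yes x) = contradiction x ¬x
  𝟙-no _  (no _)  = refl

  𝟙≤1 : (d : Dec P) → 𝟙 d ≤ 1
  𝟙≤1 (yes _) = s≤s z≤n
  𝟙≤1 (no _)  = z≤n

  𝟙-pos : (d : Dec P) → 1 ≤ 𝟙 d → P
  𝟙-pos (yes x) _ = x

𝟙-⇔ : ∀ {p q} {P : Set p} {Q : Set q} → P ⇔ Q → (d : Dec P) (e : Dec Q) → 𝟙 d ≡ 𝟙 e
𝟙-⇔ P⇔Q (yes x) e = sym (𝟙-yes (Equivalence.to P⇔Q x) e)
𝟙-⇔ P⇔Q (no ¬x) e = sym (𝟙-no (λ y → ¬x (Equivalence.from P⇔Q y)) e)

𝟙-× : ∀ {p q} {P : Set p} {Q : Set q} (d : Dec P) (e : Dec Q) → 𝟙 (d ×-dec e) ≡ 𝟙 d * 𝟙 e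
𝟙-× (yes _) (yes _) = refl
𝟙-× (yes _) (no _)  = refl
𝟙-× (no _)  _       = refl

-- Degrees are defined by filtering the list of vertices; this turns such
-- a count into a sum of indicators.
length-filter : ∀ {a p n} {A : Set a} {P : A → Set p} (P? : Decidable P) (f : Fin n → A) →
                length (filter P? (tabulate f)) ≡ sum (λ i → 𝟙 (P? (f i)))
length-filter {n = zero}  P? f = refl
length-filter {n = suc n} P? f with P? (f zero)
... | yes _ = cong suc (length-filter P? (λ i → f (suc i)))
... | no _  = length-filter P? (λ i → f (suc i))

sum-mono : ∀ {n} {f g : Fin n → ℕ} → (∀ i → f i ≤ g i) → sum f ≤ sum g
sum-mono {zero}  _   = z≤n
sum-mono {suc n} f≤g = +-mono-≤ (f≤g zero) (sum-mono (λ i → f≤g (suc i)))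

sum-zero : ∀ {n} {f : Fin n → ℕ} → (∀ i → f i ≡ 0) → sum f ≡ 0
sum-zero {n} f≡0 = trans (sum-cong-≗ f≡0) (sum-replicate-zero n)

sum-const : ∀ n c → sum {n} (λ _ → c) ≡ n * c
sum-const zero    c = refl
sum-const (suc n) c = cong (c +_) (sum-const n c)

removeAt-punchOut : ∀ {n} (f : Fin (suc n) → ℕ) {a b} (a≢b : a ≢ b) →
                    removeAt f a (punchOut a≢b) ≡ f b
removeAt-punchOut f a≢b = cong f (punchIn-punchOut a≢b)

sum-point : ∀ {n} (f : Fin n → ℕ) a → f a ≤ sum f
sum-point {suc n} f a = ≤-trans (m≤m+n (f a) _) (≤-reflexive (sym (sum-remove f)))

sum-pair : ∀ {n} (f : Fin n → ℕ) {a b} → a ≢ b → f a + f b ≤ sum f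
sum-pair {suc n} f {a} {b} a≢b = begin
  f a + f b                                 ≡⟨ cong (f a +_) (removeAt-punchOut f a≢b) ⟨
  f a + removeAt f a (punchOut a≢b)         ≤⟨ +-monoʳ-≤ (f a) (sum-point (removeAt f a) _) ⟩
  f a + sum (removeAt f a)                  ≡⟨ sum-remove f ⟨
  sum f                                     ∎
  where open ≤-Reasoning

sum-triple : ∀ {n} (f : Fin n → ℕ) {a b c} → a ≢ b → a ≢ c → b ≢ c → f a + f b + f c ≤ sum f
sum-triple {suc n} f {a} {b} {c} a≢b a≢c b≢c = begin
  f a + f b + f c
    ≡⟨ +-assoc (f a) (f b) (f c) ⟩
  f a + (f b + f c)
    ≡⟨ cong₂ (λ u v → f a + (u + v)) (removeAt-punchOut f a≢b) (removeAt-punchOut f a≢c) ⟨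
  f a + (removeAt f a b′ + removeAt f a c′)
    ≤⟨ +-monoʳ-≤ (f a) (sum-pair (removeAt f a) b′≢c′) ⟩
  f a + sum (removeAt f a)
    ≡⟨ sum-remove f ⟨
  sum f
    ∎
  where
  open ≤-Reasoning
  b′ = punchOut a≢b
  c′ = punchOut a≢c
  b′≢c′ : b′ ≢ c′
  b′≢c′ e = b≢c (trans (sym (punchIn-punchOut a≢b)) (trans (cong (punchIn a) e) (punchIn-punchOut a≢c)))

sum-single : ∀ {n} (f : Fin n → ℕ) a → (∀ i → i ≢ a → f i ≡ 0) → sum f ≡ f a
sum-single {suc n} f a vanish = begin
  sum f                    ≡⟨ sum-remove f ⟩
  f a + sum (removeAt f a) ≡⟨ cong (f a +_) (sum-zero (λ j → vanish (punchIn a j) (punchInᵢ≢i a j))) ⟩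
  f a + 0                  ≡⟨ +-identityʳ (f a) ⟩
  f a                      ∎
  where open ≡-Reasoning

sum-double : ∀ {n} (f : Fin n → ℕ) {a b} → a ≢ b → (∀ i → i ≢ a → i ≢ b → f i ≡ 0) →
             sum f ≡ f a + f b
sum-double {suc n} f {a} {b} a≢b vanish = begin
  sum f                                 ≡⟨ sum-remove f ⟩
  f a + sum (removeAt f a)              ≡⟨ cong (f a +_) (sum-single (removeAt f a) b′ vanish′) ⟩
  f a + removeAt f a b′                 ≡⟨ cong (f a +_) (removeAt-punchOut f a≢b) ⟩
  f a + f b                             ∎
  where
  open ≡-Reasoning
  b′ = punchOut a≢b
  vanish′ : ∀ j → j ≢ b′ → removeAt f a j ≡ 0
  vanish′ j j≢b′ = vanish (punchIn a j) (punchInᵢ≢i a j)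
    (λ e → j≢b′ (punchIn-injective a j b′ (trans e (sym (punchIn-punchOut a≢b)))))

sum-positive : ∀ {n} (f : Fin n → ℕ) → 1 ≤ sum f → ∃[ i ] 1 ≤ f i
sum-positive {suc n} f 1≤Σ with f zero in eq
... | suc _ = zero , subst (1 ≤_) (sym eq) (s≤s z≤n)
... | zero  with sum-positive (λ i → f (suc i)) 1≤Σ
...   | i , 1≤fi = suc i , 1≤fi

sum-removeAt-≥ : ∀ {n} (f : Fin (suc n) → ℕ) a {m} → f a ≤ 1 → suc m ≤ sum f → m ≤ sum (removeAt f a)
sum-removeAt-≥ f a fa≤1 m<Σ = +-cancelˡ-≤ 1 _ _ (begin
  suc _                    ≤⟨ m<Σ ⟩
  sum f                    ≡⟨ sum-remove f ⟩
  f a + sum (removeAt f a) ≤⟨ +-monoˡ-≤ _ fa≤1 ⟩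
  1 + sum (removeAt f a)   ∎)
  where open ≤-Reasoning

two-positive : ∀ {n} (f : Fin n → ℕ) → (∀ i → f i ≤ 1) → 2 ≤ sum f →
               ∃[ i ] ∃[ j ] i ≢ j × 1 ≤ f i × 1 ≤ f j
two-positive {suc n} f f≤1 2≤Σ with sum-positive f (≤-trans (s≤s z≤n) 2≤Σ)
... | i , 1≤fi with sum-positive (removeAt f i) (sum-removeAt-≥ f i (f≤1 i) 2≤Σ)
...   | k , 1≤fk = i , punchIn i k , (λ e → punchInᵢ≢i i k (sym e)) , 1≤fi , 1≤fk

two-positive-avoiding : ∀ {n} (f : Fin n → ℕ) → (∀ i → f i ≤ 1) → 3 ≤ sum f → ∀ v →
                        ∃[ u ] ∃[ u′ ] u ≢ v × u′ ≢ v × u ≢ u′ × 1 ≤ f u × 1 ≤ f u′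
two-positive-avoiding {suc n} f f≤1 3≤Σ v
  with two-positive (removeAt f v) (λ j → f≤1 (punchIn v j)) (sum-removeAt-≥ f v (f≤1 v) 3≤Σ)
... | j , j′ , j≢j′ , 1≤fj , 1≤fj′ =
  punchIn v j , punchIn v j′ , punchInᵢ≢i v j , punchInᵢ≢i v j′ ,
  (λ e → j≢j′ (punchIn-injective v j j′ e)) , 1≤fj , 1≤fj′

two-steps : ∀ {a b c : Bool} → a ≢ b → b ≢ c → a ≡ c
two-steps a≢b b≢c = trans (¬-not a≢b) (sym (¬-not (λ e → b≢c (sym e))))

module Codegrees {n : ℕ} (G : Graph n) where
  open Graph G

  adjacent? : ∀ x y → Dec (Adj G x y)
  adjacent? x y = adj x y ≟ᵇ true

  adj-sym : ∀ {x y} → Adj G x y → Adj G y x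
  adj-sym {x} {y} x~y = trans (symm y x) x~y

  adj-irrefl : ∀ {x y} → Adj G x y → x ≢ y
  adj-irrefl {x} x~x refl with () ← trans (sym x~x) (irrefl x)

  deg : Fin n → ℕ
  deg x = ∑[ y < n ] 𝟙 (adjacent? x y)

  degree≡deg : ∀ x → degree G x ≡ deg x
  degree≡deg x = length-filter (adjacent? x) (λ y → y)

  CommonNeighbour : Fin n → Fin n → Fin n → Set
  CommonNeighbour x y a = Adj G x a × Adj G a y

  common? : ∀ x y a → Dec (CommonNeighbour x y a)
  common? x y a = adjacent? x a ×-dec adjacent? a y

  codeg : Fin n → Fin n → ℕ
  codeg x y = ∑[ a < n ] 𝟙 (common? x y a)

  -- the closed 2-walks at x go out and back along one of its edges
  codeg-self : ∀ x → codeg x x ≡ deg x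
  codeg-self x = sum-cong-≗ (λ a → 𝟙-⇔ (mk⇔ proj₁ (λ x~a → x~a , adj-sym x~a)) (common? x x a) (adjacent? x a))

  codeg≥2 : ∀ {x y a b} → a ≢ b → CommonNeighbour x y a → CommonNeighbour x y b → 2 ≤ codeg x y
  codeg≥2 {x} {y} {a} {b} a≢b ca cb = subst (_≤ codeg x y)
    (cong₂ _+_ (𝟙-yes ca (common? x y a)) (𝟙-yes cb (common? x y b)))
    (sum-pair (λ c → 𝟙 (common? x y c)) a≢b)

  codeg≥3 : ∀ {x y a b c} → a ≢ b → a ≢ c → b ≢ c →
            CommonNeighbour x y a → CommonNeighbour x y b → CommonNeighbour x y c → 3 ≤ codeg x y
  codeg≥3 {x} {y} {a} {b} {c} a≢b a≢c b≢c ca cb cc = subst (_≤ codeg x y)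
    (cong₂ _+_ (cong₂ _+_ (𝟙-yes ca (common? x y a)) (𝟙-yes cb (common? x y b))) (𝟙-yes cc (common? x y c)))
    (sum-triple (λ d → 𝟙 (common? x y d)) a≢b a≢c b≢c)

  common-avoiding : ∀ {x y} → 3 ≤ codeg x y → ∀ v →
    ∃[ u ] ∃[ u′ ] u ≢ v × u′ ≢ v × u ≢ u′ × CommonNeighbour x y u × CommonNeighbour x y u′
  common-avoiding {x} {y} 3≤c v
    with two-positive-avoiding (λ a → 𝟙 (common? x y a)) (λ a → 𝟙≤1 (common? x y a)) 3≤c v
  ... | u , u′ , u≢v , u′≢v , u≢u′ , pu , pu′ =
    u , u′ , u≢v , u′≢v , u≢u′ , 𝟙-pos (common? x y u) pu , 𝟙-pos (common? x y u′) pu′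

  excess : Fin n → Fin n → ℕ
  excess x y with y ≟ x
  ... | yes _ = 0
  ... | no _  = codeg x y ∸ 1

  Excess : Fin n → ℕ
  Excess x = ∑[ y < n ] excess x y

  excess-off : ∀ {x y} → y ≢ x → excess x y ≡ codeg x y ∸ 1
  excess-off {x} {y} y≢x with y ≟ x
  ... | yes y≡x = contradiction y≡x y≢x
  ... | no _    = refl

  excess-≥ : ∀ {x y j} → y ≢ x → suc j ≤ codeg x y → j ≤ excess x y
  excess-≥ y≢x j<c rewrite excess-off y≢x = ∸-monoˡ-≤ 1 j<c

  codeg-≤ : ∀ {x y j} → y ≢ x → excess x y ≤ j → codeg x y ≤ suc j
  codeg-≤ {x} {y} y≢x e≤j rewrite excess-off y≢x = ≤-trans (m≤n+m∸n (codeg x y) 1) (s≤s e≤j)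

  shared-pair-excess : ∀ {x y u v} → x ≢ y → u ≢ v →
                       CommonNeighbour x y v → CommonNeighbour x y u → 1 ≤ excess v u
  shared-pair-excess x≢y u≢v (x~v , v~y) (x~u , u~y) =
    excess-≥ u≢v (codeg≥2 x≢y (adj-sym x~v , x~u) (v~y , adj-sym u~y))

  record K₂₃ (p q m₁ m₂ m₃ : Fin n) : Set where
    field
      p≢q   : p ≢ q
      m₁≢m₂ : m₁ ≢ m₂
      m₁≢m₃ : m₁ ≢ m₃
      m₂≢m₃ : m₂ ≢ m₃
      p~m₁  : Adj G p m₁
      p~m₂  : Adj G p m₂
      p~m₃  : Adj G p m₃
      q~m₁  : Adj G q m₁
      q~m₂  : Adj G q m₂
      q~m₃  : Adj G q m₃

  swap-poles : ∀ {p q m₁ m₂ m₃} → K₂₃ p q m₁ m₂ m₃ → K₂₃ q p m₁ m₂ m₃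
  swap-poles K = record
    { p≢q = λ e → p≢q (sym e) ; m₁≢m₂ = m₁≢m₂ ; m₁≢m₃ = m₁≢m₃ ; m₂≢m₃ = m₂≢m₃
    ; p~m₁ = q~m₁ ; p~m₂ = q~m₂ ; p~m₃ = q~m₃ ; q~m₁ = p~m₁ ; q~m₂ = p~m₂ ; q~m₃ = p~m₃ }
    where open K₂₃ K

  swap-middles₁₂ : ∀ {p q m₁ m₂ m₃} → K₂₃ p q m₁ m₂ m₃ → K₂₃ p q m₂ m₁ m₃
  swap-middles₁₂ K = record
    { p≢q = p≢q ; m₁≢m₂ = λ e → m₁≢m₂ (sym e) ; m₁≢m₃ = m₂≢m₃ ; m₂≢m₃ = m₁≢m₃
    ; p~m₁ = p~m₂ ; p~m₂ = p~m₁ ; p~m₃ = p~m₃ ; q~m₁ = q~m₂ ; q~m₂ = q~m₁ ; q~m₃ = q~m₃ }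
    where open K₂₃ K

  swap-middles₂₃ : ∀ {p q m₁ m₂ m₃} → K₂₃ p q m₁ m₂ m₃ → K₂₃ p q m₁ m₃ m₂
  swap-middles₂₃ K = record
    { p≢q = p≢q ; m₁≢m₂ = m₁≢m₃ ; m₁≢m₃ = m₁≢m₂ ; m₂≢m₃ = λ e → m₂≢m₃ (sym e)
    ; p~m₁ = p~m₁ ; p~m₂ = p~m₃ ; p~m₃ = p~m₂ ; q~m₁ = q~m₁ ; q~m₂ = q~m₃ ; q~m₃ = q~m₂ }
    where open K₂₃ K

  poles-codeg : ∀ {p q m₁ m₂ m₃} → K₂₃ p q m₁ m₂ m₃ → 3 ≤ codeg p q
  poles-codeg K = codeg≥3 m₁≢m₂ m₁≢m₃ m₂≢m₃
    (p~m₁ , adj-sym q~m₁) (p~m₂ , adj-sym q~m₂) (p~m₃ , adj-sym q~m₃)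
    where open K₂₃ K

  middles-codeg : ∀ {p q m₁ m₂ m₃} → K₂₃ p q m₁ m₂ m₃ → 2 ≤ codeg m₁ m₂
  middles-codeg K = codeg≥2 p≢q (adj-sym p~m₁ , p~m₂) (adj-sym q~m₁ , q~m₂)
    where open K₂₃ K

  pole-excess : ∀ {p q m₁ m₂ m₃} → K₂₃ p q m₁ m₂ m₃ → 2 ≤ excess p q
  pole-excess K = excess-≥ (λ e → K₂₃.p≢q K (sym e)) (poles-codeg K)

  middle-excess : ∀ {p q m₁ m₂ m₃} → K₂₃ p q m₁ m₂ m₃ → 1 ≤ excess m₁ m₂
  middle-excess K = excess-≥ (λ e → K₂₃.m₁≢m₂ K (sym e)) (middles-codeg K)

  InK₂₃ : Fin n → Set
  InK₂₃ v = (∃[ q ] ∃[ m₁ ] ∃[ m₂ ] ∃[ m₃ ] K₂₃ v q m₁ m₂ m₃)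
          ⊎ (∃[ p ] ∃[ q ] ∃[ m₂ ] ∃[ m₃ ] K₂₃ p q v m₂ m₃)

  K₂₃-neighbour : ∀ {v} → InK₂₃ v → ∃[ y ] Adj G v y
  K₂₃-neighbour (inj₁ (_ , m₁ , _ , _ , K)) = m₁ , K₂₃.p~m₁ K
  K₂₃-neighbour (inj₂ (p , _ , _ , _ , K))  = p , adj-sym (K₂₃.p~m₁ K)

  K₂₃-Excess : ∀ {v} → InK₂₃ v → 2 ≤ Excess v
  K₂₃-Excess {v} (inj₁ (q , _ , _ , _ , K)) = ≤-trans (pole-excess K) (sum-point (excess v) q)
  K₂₃-Excess {v} (inj₂ (_ , _ , _ , _ , K)) =
    ≤-trans (+-mono-≤ (middle-excess K) (middle-excess (swap-middles₂₃ K)))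
            (sum-pair (excess v) (K₂₃.m₂≢m₃ K))

module TwoWalks {n : ℕ} (G : Graph n) (col : Fin n → Bool)
  (proper : ∀ u v → Adj G u v → col u ≢ col v)
  (k : ℕ) (deg≤ : ∀ x → Codegrees.deg G x ≤ suc k)
  (diam : ∀ u v → Within G 3 u v) where
  open Codegrees G

  -- by the diameter bound, distinct vertices of one colour class are at
  -- distance exactly 2
  same-side-common : ∀ {x y} → col x ≡ col y → y ≢ x → ∃[ a ] CommonNeighbour x y a
  same-side-common {x} {y} same y≢x with diam x y
  ... | inj₁ x≡y = contradiction (sym x≡y) y≢x
  ... | inj₂ (a , x~a , inj₁ a≡y) =
    contradiction (trans same (cong col (sym a≡y))) (proper x a x~a)
  ... | inj₂ (a , x~a , inj₂ (b , a~b , inj₁ b≡y)) = a , x~a , subst (Adj G a) b≡y a~b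
  ... | inj₂ (a , x~a , inj₂ (b , a~b , inj₂ (c , b~c , c≡y))) =
    contradiction (trans (sym (two-steps (proper x a x~a) (proper a b a~b))) same)
                  (proper b y (subst (Adj G b) c≡y b~c))

  cross-codeg : ∀ {x y} → col x ≢ col y → codeg x y ≡ 0
  cross-codeg {x} {y} x≢y = sum-zero (λ a → 𝟙-no
    (λ (x~a , a~y) → x≢y (two-steps (proper x a x~a) (proper a y a~y))) (common? x y a))

  side : Fin n → ℕ
  side x = ∑[ y < n ] 𝟙 (col x ≟ᵇ col y)

  -- The 2-walks from x to y: deg x closed ones when y = x, one plus the
  -- excess when y ≠ x is on the side of x, and none otherwise.  (Splitting
  -- on y ≟ x also evaluates the excess, which is defined by that split.)
  walks-at : ∀ x y → codeg x y + 𝟙 (y ≟ x) ≡ 𝟙 (col x ≟ᵇ col y) + excess x y + 𝟙 (y ≟ x) * deg x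
  walks-at x y with y ≟ x
  walks-at x .x | yes refl = begin
    codeg x x + 1                                 ≡⟨ cong (_+ 1) (codeg-self x) ⟩
    deg x + 1                                     ≡⟨ +-comm (deg x) 1 ⟩
    1 + deg x                                     ≡⟨ cong suc (*-identityˡ (deg x)) ⟨
    1 + 0 + 1 * deg x                             ≡⟨ cong (λ s → s + 0 + 1 * deg x) (𝟙-yes refl (col x ≟ᵇ col x)) ⟨
    𝟙 (col x ≟ᵇ col x) + 0 + 1 * deg x          ∎
    where open ≡-Reasoning
  walks-at x y | no y≢x with col x ≟ᵇ col y
  ... | yes same = begin
    codeg x y + 0         ≡⟨ +-identityʳ (codeg x y) ⟩
    codeg x y             ≡⟨ m+[n∸m]≡n 1≤c ⟨
    1 + (codeg x y ∸ 1)   ≡⟨ +-identityʳ _ ⟨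
    1 + (codeg x y ∸ 1) + 0 ∎
    where
    open ≡-Reasoning
    1≤c : 1 ≤ codeg x y
    1≤c with same-side-common same y≢x
    ... | a , ca = ≤-trans (≤-reflexive (sym (𝟙-yes ca (common? x y a)))) (sum-point _ a)
  ... | no diff = begin
    codeg x y + 0         ≡⟨ cong (_+ 0) (cross-codeg diff) ⟩
    0                     ≡⟨ cong (λ c → c ∸ 1 + 0) (cross-codeg diff) ⟨
    codeg x y ∸ 1 + 0     ∎
    where open ≡-Reasoning

  walks₂-bound : ∀ x → ∑[ y < n ] codeg x y ≤ suc k * deg x
  walks₂-bound x = begin
    ∑[ y < n ] ∑[ a < n ] 𝟙 (common? x y a)
      ≡⟨ ∑-comm (λ y a → 𝟙 (common? x y a)) ⟩
    ∑[ a < n ] ∑[ y < n ] 𝟙 (common? x y a)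
      ≡⟨ sum-cong-≗ (λ a → sum-cong-≗ (λ y → 𝟙-× (adjacent? x a) (adjacent? a y))) ⟩
    ∑[ a < n ] ∑[ y < n ] (𝟙 (adjacent? x a) * 𝟙 (adjacent? a y))
      ≡⟨ sum-cong-≗ (λ a → *-distribˡ-sum (𝟙 (adjacent? x a)) (λ y → 𝟙 (adjacent? a y))) ⟨
    ∑[ a < n ] (𝟙 (adjacent? x a) * deg a)
      ≤⟨ sum-mono (λ a → *-monoʳ-≤ (𝟙 (adjacent? x a)) (deg≤ a)) ⟩
    ∑[ a < n ] (𝟙 (adjacent? x a) * suc k)
      ≡⟨ *-distribʳ-sum (suc k) (λ a → 𝟙 (adjacent? x a)) ⟨
    deg x * suc k
      ≡⟨ *-comm (deg x) (suc k) ⟩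
    suc k * deg x
      ∎
    where open ≤-Reasoning

  walks₂-count : ∀ x → ∑[ y < n ] codeg x y + 1 ≡ side x + Excess x + deg x
  walks₂-count x = begin
    ∑[ y < n ] codeg x y + 1
      ≡⟨ cong (∑[ y < n ] codeg x y +_) Σδ ⟨
    ∑[ y < n ] codeg x y + ∑[ y < n ] δ y
      ≡⟨ ∑-distrib-+ (codeg x) δ ⟨
    ∑[ y < n ] (codeg x y + δ y)
      ≡⟨ sum-cong-≗ (walks-at x) ⟩
    ∑[ y < n ] (same y + excess x y + δ y * deg x)
      ≡⟨ ∑-distrib-+ (λ y → same y + excess x y) (λ y → δ y * deg x) ⟩
    ∑[ y < n ] (same y + excess x y) + ∑[ y < n ] (δ y * deg x)
      ≡⟨ cong₂ _+_ (∑-distrib-+ same (excess x)) Σδdeg ⟩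
    side x + Excess x + deg x
      ∎
    where
    open ≡-Reasoning
    δ same : Fin n → ℕ
    δ y = 𝟙 (y ≟ x)
    same y = 𝟙 (col x ≟ᵇ col y)
    δ-off : ∀ y → y ≢ x → δ y ≡ 0
    δ-off y y≢x = 𝟙-no y≢x (y ≟ x)
    Σδ : ∑[ y < n ] δ y ≡ 1
    Σδ = trans (sum-single δ x δ-off) (𝟙-yes refl (x ≟ x))
    Σδdeg : ∑[ y < n ] (δ y * deg x) ≡ deg x
    Σδdeg = begin
      ∑[ y < n ] (δ y * deg x) ≡⟨ sum-single (λ y → δ y * deg x) x (λ y y≢x → cong (_* deg x) (δ-off y y≢x)) ⟩
      δ x * deg x              ≡⟨ cong (_* deg x) (𝟙-yes refl (x ≟ x)) ⟩
      1 * deg x                ≡⟨ *-identityˡ (deg x) ⟩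
      deg x                    ∎

  -- the colour class of x and the excess at x together fit into half of
  -- the bipartite Moore bound, 1 + (d - 1) + (d - 1)² = 1 + k · suc k
  side+Excess≤ : ∀ x → side x + Excess x ≤ 1 + k * suc k
  side+Excess≤ x = ≤-trans (+-cancelʳ-≤ (deg x) _ _ count) (+-monoʳ-≤ 1 (*-monoʳ-≤ k (deg≤ x)))
    where
    open ≤-Reasoning
    count : side x + Excess x + deg x ≤ 1 + k * deg x + deg x
    count = begin
      side x + Excess x + deg x  ≡⟨ walks₂-count x ⟨
      ∑[ y < n ] codeg x y + 1   ≤⟨ +-monoˡ-≤ 1 (walks₂-bound x) ⟩
      suc k * deg x + 1          ≡⟨ shuffle k (deg x) ⟩
      1 + k * deg x + deg x      ∎
      where
      shuffle : ∀ k d → suc k * d + 1 ≡ 1 + k * d + d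
      shuffle = solve-∀

  sides : ∀ {x y} → Adj G x y → side x + side y ≡ n
  sides {x} {y} x~y = begin
    side x + side y
      ≡⟨ ∑-distrib-+ (λ i → 𝟙 (col x ≟ᵇ col i)) (λ i → 𝟙 (col y ≟ᵇ col i)) ⟨
    ∑[ i < n ] (𝟙 (col x ≟ᵇ col i) + 𝟙 (col y ≟ᵇ col i))
      ≡⟨ sum-cong-≗ one-side ⟩
    ∑[ i < n ] 1
      ≡⟨ sum-const n 1 ⟩
    n * 1
      ≡⟨ *-identityʳ n ⟩
    n
      ∎
    where
    open ≡-Reasoning
    one-side : ∀ i → 𝟙 (col x ≟ᵇ col i) + 𝟙 (col y ≟ᵇ col i) ≡ 1
    one-side i with col x ≟ᵇ col i | col y ≟ᵇ col i
    ... | yes x≡i | yes y≡i = contradiction (trans x≡i (sym y≡i)) (proper x y x~y)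
    ... | yes _   | no _    = refl
    ... | no _    | yes _   = refl
    ... | no x≢i  | no y≢i  = contradiction (two-steps x≢i (λ e → y≢i (sym e))) (proper x y x~y)

  adjacent-Excess : ∀ {x y} → Adj G x y → n + (Excess x + Excess y) ≤ 2 * (1 + k * suc k)
  adjacent-Excess {x} {y} x~y = begin
    n + (Excess x + Excess y)                      ≡⟨ cong (_+ (Excess x + Excess y)) (sides x~y) ⟨
    side x + side y + (Excess x + Excess y)        ≡⟨ interchange (side x) (side y) (Excess x) (Excess y) ⟩
    side x + Excess x + (side y + Excess y)        ≤⟨ +-mono-≤ (side+Excess≤ x) (side+Excess≤ y) ⟩
    1 + k * suc k + (1 + k * suc k)                ≡⟨ cong (1 + k * suc k +_) (+-identityʳ _) ⟨
    2 * (1 + k * suc k)                            ∎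
    where open ≤-Reasoning

no-room : ∀ {a b} → 2 ≤ a → a + b ≤ 2 → b ≡ 0
no-room {a} {b} 2≤a a+b≤2 = n≤0⇒n≡0 (+-cancelˡ-≤ 2 b 0 (≤-trans (+-monoˡ-≤ b 2≤a) a+b≤2))

one-room : ∀ {a b} → 1 ≤ a → a + b ≤ 2 → b ≤ 1
one-room {a} {b} 1≤a a+b≤2 = +-cancelˡ-≤ 1 b 1 (≤-trans (+-monoˡ-≤ b 1≤a) a+b≤2)

module ThickPairs {n : ℕ} (G : Graph n) (tight : ∀ x → Codegrees.Excess G x ≤ 2) where
  open Codegrees G

  Thick : Fin n → Fin n → Set
  Thick x y = y ≢ x × 3 ≤ codeg x y

  thick? : ∀ x y → Dec (Thick x y)
  thick? x y = ¬? (y ≟ x) ×-dec (3 ≤? codeg x y)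

  excess≤2 : ∀ x y → excess x y ≤ 2
  excess≤2 x y = ≤-trans (sum-point (excess x) y) (tight x)

  pair-excess≤2 : ∀ x {a b} → a ≢ b → excess x a + excess x b ≤ 2
  pair-excess≤2 x a≢b = ≤-trans (sum-pair (excess x) a≢b) (tight x)

  thick-codeg : ∀ {x y} → Thick x y → codeg x y ≡ 3
  thick-codeg {x} {y} (y≢x , 3≤c) = ≤-antisym (codeg-≤ y≢x (excess≤2 x y)) 3≤c

  poles-thick : ∀ {p q m₁ m₂ m₃} → K₂₃ p q m₁ m₂ m₃ → Thick p q
  poles-thick K = (λ e → K₂₃.p≢q K (sym e)) , poles-codeg K

  partners : Fin n → ℕ
  partners x = ∑[ y < n ] 𝟙 (thick? x y)

  spanned : Fin n → ℕ
  spanned v = ∑[ x < n ] ∑[ y < n ] 𝟙 (common? x y v ×-dec thick? x y)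

  -- double counting the triples (x , y , v) with (x , y) thick and v a
  -- common neighbour
  spanned-total : ∑[ v < n ] spanned v ≡ 3 * ∑[ x < n ] partners x
  spanned-total = begin
    ∑[ v < n ] ∑[ x < n ] ∑[ y < n ] t v x y
      ≡⟨ ∑-comm (λ v x → ∑[ y < n ] t v x y) ⟩
    ∑[ x < n ] ∑[ v < n ] ∑[ y < n ] t v x y
      ≡⟨ sum-cong-≗ (λ x → ∑-comm (λ v y → t v x y)) ⟩
    ∑[ x < n ] ∑[ y < n ] ∑[ v < n ] t v x y
      ≡⟨ sum-cong-≗ (λ x → sum-cong-≗ (λ y → column x y)) ⟩
    ∑[ x < n ] ∑[ y < n ] (3 * 𝟙 (thick? x y))
      ≡⟨ sum-cong-≗ (λ x → *-distribˡ-sum 3 (λ y → 𝟙 (thick? x y))) ⟨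
    ∑[ x < n ] (3 * partners x)
      ≡⟨ *-distribˡ-sum 3 partners ⟨
    3 * ∑[ x < n ] partners x
      ∎
    where
    open ≡-Reasoning
    t : Fin n → Fin n → Fin n → ℕ
    t v x y = 𝟙 (common? x y v ×-dec thick? x y)
    weight : ∀ x y → codeg x y * 𝟙 (thick? x y) ≡ 3 * 𝟙 (thick? x y)
    weight x y with thick? x y
    ... | yes xy-thick = cong (_* 1) (thick-codeg xy-thick)
    ... | no _         = *-zeroʳ (codeg x y)
    column : ∀ x y → ∑[ v < n ] t v x y ≡ 3 * 𝟙 (thick? x y)
    column x y = begin
      ∑[ v < n ] t v x y
        ≡⟨ sum-cong-≗ (λ v → 𝟙-× (common? x y v) (thick? x y)) ⟩
      ∑[ v < n ] (𝟙 (common? x y v) * 𝟙 (thick? x y))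
        ≡⟨ *-distribʳ-sum (𝟙 (thick? x y)) (λ v → 𝟙 (common? x y v)) ⟨
      codeg x y * 𝟙 (thick? x y)
        ≡⟨ weight x y ⟩
      3 * 𝟙 (thick? x y)
        ∎

  around-thick : ∀ {x y v} → CommonNeighbour x y v → Thick x y →
    ∃[ u ] ∃[ u′ ] u ≢ u′ × 1 ≤ excess v u × 1 ≤ excess v u′
                   × CommonNeighbour x y u × CommonNeighbour x y u′
  around-thick {x} {y} {v} cv (y≢x , 3≤c) with common-avoiding 3≤c v
  ... | u , u′ , u≢v , u′≢v , u≢u′ , cu , cu′ =
    u , u′ , u≢u′ , shared-pair-excess x≢y u≢v cv cu , shared-pair-excess x≢y u′≢v cv cu′ , cu , cu′
    where
    x≢y : x ≢ y
    x≢y e = y≢x (sym e)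

  module Pole {v q m₁ m₂ m₃} (K : K₂₃ v q m₁ m₂ m₃) where

    excess-elsewhere : ∀ {u} → u ≢ q → excess v u ≡ 0
    excess-elsewhere u≢q = no-room (pole-excess K) (pair-excess≤2 v (λ e → u≢q (sym e)))

    excess-at-q : ∀ {u} → 1 ≤ excess v u → u ≡ q
    excess-at-q {u} 1≤e with u ≟ q
    ... | yes u≡q = u≡q
    ... | no u≢q  = contradiction (subst (1 ≤_) (excess-elsewhere u≢q) 1≤e) λ ()

    partners-pole : partners v ≡ 1
    partners-pole = trans (sum-single (λ y → 𝟙 (thick? v y)) q not-thick) (𝟙-yes (poles-thick K) (thick? v q))
      where
      not-thick : ∀ y → y ≢ q → 𝟙 (thick? v y) ≡ 0
      not-thick y y≢q = 𝟙-no (λ (y≢v , 3≤c) → y≢q (excess-at-q (≤-trans (s≤s z≤n) (excess-≥ y≢v 3≤c))))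
                             (thick? v y)

    spanned-pole : spanned v ≡ 0
    spanned-pole = sum-zero λ x → sum-zero λ y →
      𝟙-no (uncurry not-surrounded) (common? x y v ×-dec thick? x y)
      where
      not-surrounded : ∀ {x y} → CommonNeighbour x y v → Thick x y → ⊥
      not-surrounded cv t with around-thick cv t
      ... | u , u′ , u≢u′ , eu , eu′ , _ = u≢u′ (trans (excess-at-q eu) (sym (excess-at-q eu′)))

  module Middle {p q v m₂ m₃} (K : K₂₃ p q v m₂ m₃) where
    open K₂₃ K using (p≢q; m₂≢m₃)

    excess-m₂ : 1 ≤ excess v m₂
    excess-m₂ = middle-excess K

    excess-m₃ : 1 ≤ excess v m₃
    excess-m₃ = middle-excess (swap-middles₂₃ K)

    excess-elsewhere : ∀ {u} → u ≢ m₂ → u ≢ m₃ → excess v u ≡ 0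
    excess-elsewhere u≢m₂ u≢m₃ = no-room (+-mono-≤ excess-m₂ excess-m₃)
      (≤-trans (sum-triple (excess v) m₂≢m₃ (λ e → u≢m₂ (sym e)) (λ e → u≢m₃ (sym e))) (tight v))

    excess≤1 : ∀ u → excess v u ≤ 1
    excess≤1 u with u ≟ m₂
    ... | yes refl = one-room excess-m₃ (pair-excess≤2 v (λ e → m₂≢m₃ (sym e)))
    ... | no u≢m₂  = one-room excess-m₂ (pair-excess≤2 v (λ e → u≢m₂ (sym e)))

    codeg≤2 : ∀ {u} → u ≢ v → codeg v u ≤ 2
    codeg≤2 {u} u≢v = codeg-≤ u≢v (excess≤1 u)

    partners-middle : partners v ≡ 0
    partners-middle = sum-zero λ y →
      𝟙-no (λ (y≢v , 3≤c) → contradiction (≤-trans 3≤c (codeg≤2 y≢v)) λ { (s≤s (s≤s ())) }) (thick? v y)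

    excess-at : ∀ {u} → 1 ≤ excess v u → u ≡ m₂ ⊎ u ≡ m₃
    excess-at {u} 1≤e with u ≟ m₂ | u ≟ m₃
    ... | yes u≡m₂ | _        = inj₁ u≡m₂
    ... | no _     | yes u≡m₃ = inj₂ u≡m₃
    ... | no u≢m₂  | no u≢m₃  = contradiction (subst (1 ≤_) (excess-elsewhere u≢m₂ u≢m₃) 1≤e) λ ()

    poles-common : ∀ {u} → u ≡ m₂ ⊎ u ≡ m₃ → u ≢ v × CommonNeighbour v u p × CommonNeighbour v u q
    poles-common (inj₁ refl) = (λ e → m₁≢m₂ (sym e)) , (adj-sym p~m₁ , p~m₂) , (adj-sym q~m₁ , q~m₂)
      where open K₂₃ K
    poles-common (inj₂ refl) = (λ e → m₁≢m₃ (sym e)) , (adj-sym p~m₁ , p~m₃) , (adj-sym q~m₁ , q~m₃)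
      where open K₂₃ K

    common-pole : ∀ {u z} → u ≡ m₂ ⊎ u ≡ m₃ → CommonNeighbour v u z → z ≡ p ⊎ z ≡ q
    common-pole {u} {z} u-mid cz with z ≟ p | z ≟ q | poles-common u-mid
    ... | yes z≡p | _       | _ = inj₁ z≡p
    ... | no _    | yes z≡q | _ = inj₂ z≡q
    ... | no z≢p  | no z≢q  | u≢v , cp , cq =
      contradiction (≤-trans (codeg≥3 p≢q (λ e → z≢p (sym e)) (λ e → z≢q (sym e)) cp cq cz) (codeg≤2 u≢v))
                    λ { (s≤s (s≤s ())) }

    toward-poles : ∀ {x y} → CommonNeighbour x y v → Thick x y → (x ≡ p × y ≡ q) ⊎ (x ≡ q × y ≡ p)
    toward-poles {x} {y} (x~v , v~y) t@(y≢x , _) with around-thick (x~v , v~y) t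
    ... | u , _ , _ , eu , _ , (x~u , u~y) , _
      with common-pole (excess-at eu) (adj-sym x~v , x~u) | common-pole (excess-at eu) (v~y , adj-sym u~y)
    ... | inj₁ x≡p | inj₁ y≡p = contradiction (trans y≡p (sym x≡p)) y≢x
    ... | inj₁ x≡p | inj₂ y≡q = inj₁ (x≡p , y≡q)
    ... | inj₂ x≡q | inj₁ y≡p = inj₂ (x≡q , y≡p)
    ... | inj₂ x≡q | inj₂ y≡q = contradiction (trans y≡q (sym x≡q)) y≢x

    other-row : ∀ {x} → x ≢ p → x ≢ q → ∑[ y < n ] 𝟙 (common? x y v ×-dec thick? x y) ≡ 0
    other-row {x} x≢p x≢q = sum-zero λ y →
      𝟙-no (λ (cv , th) → [ x≢p ∘ proj₁ , x≢q ∘ proj₁ ] (toward-poles cv th)) (common? x y v ×-dec thick? x y)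

    pole-row : ∑[ y < n ] 𝟙 (common? p y v ×-dec thick? p y) ≡ 1
    pole-row = trans (sum-single (λ y → 𝟙 (common? p y v ×-dec thick? p y)) q off-q)
                     (𝟙-yes ((p~m₁ , adj-sym q~m₁) , poles-thick K) (common? p q v ×-dec thick? p q))
      where
      open K₂₃ K using (p~m₁; q~m₁)
      off-q : ∀ y → y ≢ q → 𝟙 (common? p y v ×-dec thick? p y) ≡ 0
      off-q y y≢q = 𝟙-no (λ (cv , th) → [ y≢q ∘ proj₂ , p≢q ∘ proj₁ ] (toward-poles cv th))
                         (common? p y v ×-dec thick? p y)

  -- a middle vertex is a common neighbour of exactly the ordered thick
  -- pairs (p , q) and (q , p); the row of q is the row of p for K with
  -- its poles swapped
  spanned-middle : ∀ {p q v m₂ m₃} → K₂₃ p q v m₂ m₃ → spanned v ≡ 2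
  spanned-middle {p} {q} {v} K = begin
    ∑[ x < n ] row x           ≡⟨ sum-double row (K₂₃.p≢q K) (λ x → Middle.other-row K) ⟩
    row p + row q              ≡⟨ cong₂ _+_ (Middle.pole-row K) (Middle.pole-row (swap-poles K)) ⟩
    2                          ∎
    where
    open ≡-Reasoning
    row : Fin n → ℕ
    row x = ∑[ y < n ] 𝟙 (common? x y v ×-dec thick? x y)

  local-count : ∀ {v} → InK₂₃ v → spanned v + 2 * partners v ≡ 2
  local-count (inj₁ (_ , _ , _ , _ , K)) =
    cong₂ (λ s p → s + 2 * p) (Pole.spanned-pole K) (Pole.partners-pole K)
  local-count (inj₂ (_ , _ , _ , _ , K)) =
    cong₂ (λ s p → s + 2 * p) (spanned-middle K) (Middle.partners-middle K)

  five-partners : (∀ v → InK₂₃ v) → 5 * ∑[ x < n ] partners x ≡ 2 * n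
  five-partners all-K₂₃ = begin
    5 * P
      ≡⟨ *-distribʳ-+ P 3 2 ⟩
    3 * P + 2 * P
      ≡⟨ cong₂ _+_ spanned-total (sym (*-distribˡ-sum 2 partners)) ⟨
    ∑[ v < n ] spanned v + ∑[ v < n ] (2 * partners v)
      ≡⟨ ∑-distrib-+ spanned (λ v → 2 * partners v) ⟨
    ∑[ v < n ] (spanned v + 2 * partners v)
      ≡⟨ sum-cong-≗ (λ v → local-count (all-K₂₃ v)) ⟩
    ∑[ v < n ] 2
      ≡⟨ sum-const n 2 ⟩
    n * 2
      ≡⟨ *-comm n 2 ⟩
    2 * n
      ∎
    where
    open ≡-Reasoning
    P : ℕ
    P = ∑[ x < n ] partners x

module Squares {n : ℕ} (G : Graph n) (col : Fin n → Bool)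
  (proper : ∀ u v → Adj G u v → col u ≢ col v) where
  open Codegrees G

  record Square : Set where
    field
      a b c d : Fin n
      a≢c     : a ≢ c
      b≢d     : b ≢ d
      a~b     : Adj G a b
      b~c     : Adj G b c
      c~d     : Adj G c d
      d~a     : Adj G d a

  Corner : Square → Fin n → Set
  Corner S u = u ≡ a ⊎ u ≡ b ⊎ u ≡ c ⊎ u ≡ d
    where open Square S

  rotate : Square → Square
  rotate S = record
    { a = b ; b = c ; c = d ; d = a ; a≢c = b≢d ; b≢d = λ e → a≢c (sym e)
    ; a~b = b~c ; b~c = c~d ; c~d = d~a ; d~a = a~b }
    where open Square S

  rotate-corner : ∀ S {u} → Corner S u → Corner (rotate S) u
  rotate-corner _ (inj₁ u≡a)                = inj₂ (inj₂ (inj₂ u≡a))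
  rotate-corner _ (inj₂ (inj₁ u≡b))         = inj₁ u≡b
  rotate-corner _ (inj₂ (inj₂ (inj₁ u≡c)))  = inj₂ (inj₁ u≡c)
  rotate-corner _ (inj₂ (inj₂ (inj₂ u≡d)))  = inj₂ (inj₂ (inj₁ u≡d))

  unrotate-corner : ∀ S {u} → Corner (rotate S) u → Corner S u
  unrotate-corner _ (inj₁ u≡b)                = inj₂ (inj₁ u≡b)
  unrotate-corner _ (inj₂ (inj₁ u≡c))         = inj₂ (inj₂ (inj₁ u≡c))
  unrotate-corner _ (inj₂ (inj₂ (inj₁ u≡d)))  = inj₂ (inj₂ (inj₂ u≡d))
  unrotate-corner _ (inj₂ (inj₂ (inj₂ u≡a)))  = inj₁ u≡a

  record Completion (On : Fin n → Set) (x y z : Fin n) : Set where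
    field
      w     : Fin n
      on-w  : On w
      w≢y   : w ≢ y
      x~w   : Adj G x w
      z~w   : Adj G z w
      cover : ∀ {u} → On u → u ≡ x ⊎ u ≡ y ⊎ u ≡ z ⊎ u ≡ w

  transport : ∀ {On On′ : Fin n → Set} {x y z} → (∀ {u} → On u → On′ u) → (∀ {u} → On′ u → On u) →
              Completion On x y z → Completion On′ x y z
  transport to from F = record
    { w = w ; on-w = to on-w ; w≢y = w≢y ; x~w = x~w ; z~w = z~w ; cover = λ u∈ → cover (from u∈) }
    where open Completion F

  unrotate-completion : ∀ S {x y z} → Completion (Corner (rotate S)) x y z → Completion (Corner S) x y z
  unrotate-completion S = transport (unrotate-corner S) (rotate-corner S)

  opposite-a : ∀ S {u} → Corner S u → col u ≢ col (Square.a S) → u ≡ Square.b S ⊎ u ≡ Square.d S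
  opposite-a S (inj₁ refl)                u≢a = contradiction refl u≢a
  opposite-a S (inj₂ (inj₁ u≡b))          _   = inj₁ u≡b
  opposite-a S (inj₂ (inj₂ (inj₁ refl)))  c≢a =
    contradiction (two-steps (λ e → proper _ _ b~c (sym e)) (λ e → proper _ _ a~b (sym e))) c≢a
    where open Square S
  opposite-a S (inj₂ (inj₂ (inj₂ u≡d)))   _   = inj₂ u≡d

  complete-at-a : ∀ S {x z} → Corner S x → Corner S z → Adj G x (Square.a S) → Adj G z (Square.a S) → x ≢ z →
                  Completion (Corner S) x (Square.a S) z
  complete-at-a S {x} {z} cx cz x~a z~a x≢z
    with opposite-a S cx (proper _ _ x~a) | opposite-a S cz (proper _ _ z~a)
  ... | inj₁ refl | inj₁ refl = contradiction refl x≢z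
  ... | inj₂ refl | inj₂ refl = contradiction refl x≢z
  ... | inj₁ refl | inj₂ refl = record
    { w = c ; on-w = inj₂ (inj₂ (inj₁ refl)) ; w≢y = λ e → a≢c (sym e) ; x~w = b~c ; z~w = adj-sym c~d
    ; cover = λ { (inj₁ u≡a)               → inj₂ (inj₁ u≡a)
                ; (inj₂ (inj₁ u≡b))        → inj₁ u≡b
                ; (inj₂ (inj₂ (inj₁ u≡c))) → inj₂ (inj₂ (inj₂ u≡c))
                ; (inj₂ (inj₂ (inj₂ u≡d))) → inj₂ (inj₂ (inj₁ u≡d)) } }
    where open Square S
  ... | inj₂ refl | inj₁ refl = record
    { w = c ; on-w = inj₂ (inj₂ (inj₁ refl)) ; w≢y = λ e → a≢c (sym e) ; x~w = adj-sym c~d ; z~w = b~c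
    ; cover = λ { (inj₁ u≡a)               → inj₂ (inj₁ u≡a)
                ; (inj₂ (inj₁ u≡b))        → inj₂ (inj₂ (inj₁ u≡b))
                ; (inj₂ (inj₂ (inj₁ u≡c))) → inj₂ (inj₂ (inj₂ u≡c))
                ; (inj₂ (inj₂ (inj₂ u≡d))) → inj₁ u≡d } }
    where open Square S

  -- the general case, rotating the square until y is the corner a
  complete : ∀ S {x y z} → Corner S x → Corner S y → Corner S z → Adj G x y → Adj G z y → x ≢ z →
             Completion (Corner S) x y z
  complete S cx (inj₁ refl) cz x~y z~y x≢z = complete-at-a S cx cz x~y z~y x≢z
  complete S cx (inj₂ (inj₁ refl)) cz x~y z~y x≢z =
    unrotate-completion S (complete-at-a S₁ (rotate-corner S cx) (rotate-corner S cz) x~y z~y x≢z)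
    where S₁ = rotate S
  complete S cx (inj₂ (inj₂ (inj₁ refl))) cz x~y z~y x≢z =
    unrotate-completion S (unrotate-completion S₁
      (complete-at-a S₂ (rotate-corner S₁ (rotate-corner S cx)) (rotate-corner S₁ (rotate-corner S cz)) x~y z~y x≢z))
    where S₁ = rotate S
          S₂ = rotate S₁
  complete S cx (inj₂ (inj₂ (inj₂ refl))) cz x~y z~y x≢z =
    unrotate-completion S (unrotate-completion S₁ (unrotate-completion S₂
      (complete-at-a S₃ (rotate-corner S₂ (rotate-corner S₁ (rotate-corner S cx)))
                        (rotate-corner S₂ (rotate-corner S₁ (rotate-corner S cz))) x~y z~y x≢z)))
    where S₁ = rotate S
          S₂ = rotate S₁
          S₃ = rotate S₂

  -- a short cycle in a 2-coloured graph is a square: a triangle cannot be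
  -- properly 2-coloured, and a 4-cycle is read off its vertex sequence
  cycle-square : (C : ShortCycle G) → ∃[ S ] (∀ u → OnCycle G C u ⇔ Corner S u)
  cycle-square record { len₋₁ = zero ; 3≤len = s≤s () }
  cycle-square record { len₋₁ = suc zero ; 3≤len = s≤s (s≤s ()) }
  cycle-square record { len₋₁ = suc (suc zero) ; vert = f ; adjc = adjc } =
    contradiction (two-steps (proper _ _ (adjc zero)) (proper _ _ (adjc (suc zero))))
                  (λ e → proper _ _ (adjc (suc (suc zero))) (sym e))
  cycle-square C@(record { len₋₁ = suc (suc (suc zero)) ; vert = f ; inj = inj ; adjc = adjc }) =
    S , λ u → mk⇔ to from
    where
    S : Square
    S = record
      { a = f zero ; b = f (suc zero) ; c = f (suc (suc zero)) ; d = f (suc (suc (suc zero)))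
      ; a≢c = λ e → case inj e of λ () ; b≢d = λ e → case inj e of λ ()
      ; a~b = adjc zero ; b~c = adjc (suc zero) ; c~d = adjc (suc (suc zero)) ; d~a = adjc (suc (suc (suc zero))) }
    to : ∀ {u} → OnCycle G C u → Corner S u
    to (zero , refl)                   = inj₁ refl
    to (suc zero , refl)               = inj₂ (inj₁ refl)
    to (suc (suc zero) , refl)         = inj₂ (inj₂ (inj₁ refl))
    to (suc (suc (suc zero)) , refl)   = inj₂ (inj₂ (inj₂ refl))
    from : ∀ {u} → Corner S u → OnCycle G C u
    from (inj₁ refl)                = zero , refl
    from (inj₂ (inj₁ refl))         = suc zero , refl
    from (inj₂ (inj₂ (inj₁ refl)))  = suc (suc zero) , refl
    from (inj₂ (inj₂ (inj₂ refl)))  = suc (suc (suc zero)) , refl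
  cycle-square record { len₋₁ = suc (suc (suc (suc _))) ; len≤4 = s≤s (s≤s (s≤s (s≤s ()))) }

  cycle-edge : ∀ C {u v} → CycleEdge G C u v → OnCycle G C u × OnCycle G C v × Adj G u v
  cycle-edge C (i , inj₁ (refl , refl)) = (i , refl) , (next i , refl) , ShortCycle.adjc C i
  cycle-edge C (i , inj₂ (refl , refl)) = (next i , refl) , (i , refl) , adj-sym (ShortCycle.adjc C i)

  fourth-corner : ∀ C {x y z} → CycleEdge G C x y → CycleEdge G C y z → x ≢ z → Completion (OnCycle G C) x y z
  fourth-corner C xy yz x≢z with cycle-square C | cycle-edge C xy | cycle-edge C yz
  ... | S , on⇔corner | x∈C , y∈C , x~y | _ , z∈C , y~z =
    transport from to (complete S (to x∈C) (to y∈C) (to z∈C) x~y (adj-sym y~z) x≢z)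
    where
    to   = λ {u} → Equivalence.to (on⇔corner u)
    from = λ {u} → Equivalence.from (on⇔corner u)

  -- Every vertex of Γ₂ lies in a K₂,₃: the short cycle C through it and a
  -- neighbour D of C are squares through the common path x - y - z; their
  -- fourth corners w_C ≠ w_D make x, z the poles and y, w_C, w_D the middles.
  Γ₂⊆K₂₃ : ∀ {v} → InΓ₂ G v → InK₂₃ v
  Γ₂⊆K₂₃ {v} (C , ((D , C~D) , all-P₂) , v∈C)
    with all-P₂ D C~D
  ... | x , y , z , _ , _ , x≢z , common-vertex , common-edge = by-corner (cover FC v∈C)
    where
    open Completion
    xy = Equivalence.from (common-edge x y) (inj₁ (inj₁ (refl , refl)))
    yz = Equivalence.from (common-edge y z) (inj₂ (inj₁ (refl , refl)))
    x~y = proj₂ (proj₂ (cycle-edge C (proj₁ xy)))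
    z~y = adj-sym (proj₂ (proj₂ (cycle-edge C (proj₁ yz))))
    FC = fourth-corner C (proj₁ xy) (proj₁ yz) x≢z
    FD = fourth-corner D (proj₂ xy) (proj₂ yz) x≢z
    wC≢wD : w FC ≢ w FD
    wC≢wD e with Equivalence.to (common-vertex (w FC)) (on-w FC , subst (OnCycle G D) (sym e) (on-w FD))
    ... | inj₁ w≡x         = adj-irrefl (x~w FC) (sym w≡x)
    ... | inj₂ (inj₁ w≡y)  = w≢y FC w≡y
    ... | inj₂ (inj₂ w≡z)  = adj-irrefl (z~w FC) (sym w≡z)
    K : K₂₃ x z y (w FC) (w FD)
    K = record
      { p≢q = x≢z ; m₁≢m₂ = λ e → w≢y FC (sym e) ; m₁≢m₃ = λ e → w≢y FD (sym e) ; m₂≢m₃ = wC≢wD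
      ; p~m₁ = x~y ; p~m₂ = x~w FC ; p~m₃ = x~w FD ; q~m₁ = z~y ; q~m₂ = z~w FC ; q~m₃ = z~w FD }
    by-corner : v ≡ x ⊎ v ≡ y ⊎ v ≡ z ⊎ v ≡ w FC → InK₂₃ v
    by-corner (inj₁ v≡x)               = subst InK₂₃ (sym v≡x) (inj₁ (_ , _ , _ , _ , K))
    by-corner (inj₂ (inj₁ v≡y))        = subst InK₂₃ (sym v≡y) (inj₂ (_ , _ , _ , _ , K))
    by-corner (inj₂ (inj₂ (inj₁ v≡z))) = subst InK₂₃ (sym v≡z) (inj₁ (_ , _ , _ , _ , swap-poles K))
    by-corner (inj₂ (inj₂ (inj₂ v≡w))) = subst InK₂₃ (sym v≡w) (inj₂ (_ , _ , _ , _ , swap-middles₁₂ K))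

-- For 82 = M^b(7,3) − 4 vertices, an edge whose ends have total excess at
-- most the defect 4 leaves excess at most 2 at one end if the other has 2.
defect-share : ∀ {a b} → 82 + (a + b) ≤ 2 * (1 + 6 * 7) → 2 ≤ b → a ≤ 2
defect-share {a} {b} bound 2≤b =
  +-cancelʳ-≤ 2 a 2 (≤-trans (+-monoʳ-≤ a 2≤b) (+-cancelˡ-≤ 82 (a + b) 4 bound))

not-multiple-of-5 : ∀ m → 5 * m ≢ 2 * 82
not-multiple-of-5 m e with () ← trans (sym (m*n%n≡0 m 5)) (cong (_% 5) (trans (*-comm m 5) e))

proposition4p1 : (Γ : Graph 82) → BipartiteGraph Γ 7 3 → ¬ (∀ (v : Fin 82) → InΓ₂ Γ v)
proposition4p1 Γ ((col , proper) , (degree≤ , _) , (diam , _)) all-Γ₂ =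
  not-multiple-of-5 (∑[ x < 82 ] partners x) (five-partners all-K₂₃)
  where
  open Codegrees Γ
  all-K₂₃ : ∀ v → InK₂₃ v
  all-K₂₃ v = Squares.Γ₂⊆K₂₃ Γ col proper (all-Γ₂ v)
  deg≤ : ∀ v → deg v ≤ 7
  deg≤ v = subst (_≤ 7) (degree≡deg v) (degree≤ v)
  tight : ∀ x → Excess x ≤ 2
  tight x with K₂₃-neighbour (all-K₂₃ x)
  ... | y , x~y = defect-share (TwoWalks.adjacent-Excess Γ col proper 6 deg≤ diam x~y) (K₂₃-Excess (all-K₂₃ y))
  open ThickPairs Γ tight
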